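{- Let $n\geq 5$ be an integer. Then there exist infinitely many triples $(a,b,c)$ of rational numbers such that the system of Diophantine equations \[ \sigma_{1}(x_{1},\ldots,x_{n})=a,\qquad \sigma_{2}(x_{1},\ldots,x_{n})=b,\qquad \sigma_{3}(x_{1},\ldots,x_{n})=c \] has infinitely many solutions $(x_{1},\ldots,x_{n})$ in rational numbers.
   Context: For $1\leq i\leq n$, $\sigma_{i}(x_{1},\ldots,x_{n})=\sum_{1\leq k_{1}<\cdots<k_{i}\leq n}x_{k_{1}}\cdots x_{k_{i}}$ denotes the $i$-th elementary symmetric polynomial. -}

module Defs where

open import Data.Nat using (ℕ; zero; suc)
open import Data.Rational using (ℚ; _+_; _*_; 0ℚ; 1ℚ)
open import Data.Vec using (Vec; []; _∷_)
open import Data.Product using (_×_; Σ; _,_)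
open import Function.Definitions using (Injective)
open import Relation.Binary.PropositionalEquality using (_≡_)

σ : ∀ {m} → ℕ → Vec ℚ m → ℚ
σ zero    _        = 1ℚ
σ (suc k) []       = 0ℚ
σ (suc k) (x ∷ xs) = x * σ k xs + σ (suc k) xs

Infinitely : ∀ {a p} (A : Set a) → (A → Set p) → Set _
Infinitely A P = Σ (ℕ → A) λ f → Injective _≡_ _≡_ f × (∀ i → P (f i))

Solves : ∀ {n} → ℚ × ℚ × ℚ → Vec ℚ n → Set
Solves (a , b , c) x = σ 1 x ≡ a × σ 2 x ≡ b × σ 3 x ≡ c

{-# OPTIONS --safe #-}
-- If u² + v² = 1, the four numbers 1 ± u, 1 ± v have σ₁ = 4, σ₂ = 6 − (u² + v²) = 5 and
-- σ₃ = 4 − 2(u² + v²) = 2, and the unit circle has infinitely many rational points.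
-- Since σₖ is homogeneous of degree k, scaling by l gives a solution for (4l, 5l², 2l³),
-- and appending zeros changes no σₖ, so every length n ≥ 4 is reached.
module Submission where

open import Defs
open import Data.Nat using (ℕ; _≥_; zero; suc; s≤s)
open import Data.Rational using (ℚ)
open import Data.Vec using (Vec)
open import Data.Product using (_×_)

open import Algebra.Definitions.RawSemiring Data.Rational.+-*-rawSemiring using (_^_)
open import Data.Integer using (+_)
import Data.Integer.Properties as ℤ
import Data.Nat.Properties as ℕ
open import Data.Product using (_,_; proj₁; proj₂; uncurry)
open import Data.Rational
  using (0ℚ; 1ℚ; _+_; _*_; _-_; -_; 1/_; ↥_; NonZero; Positive; NonNegative)
open import Data.Rational.Literals using (fromℤ)
open import Data.Rational.Properties
open import Data.Rational.Solver using (module +-*-Solver)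
open import Data.Vec using ([]; _∷_; _++_; replicate; map)
open import Data.Vec.Properties using (∷-injective; ++-injectiveˡ)
open import Function.Definitions using (Injective)
open import Relation.Binary.PropositionalEquality

open +-*-Solver using (solve; _:=_; _:+_; _:*_; _:-_; :-_; con; Polynomial)
open import Algebra.Properties.Group +-0-group using (∙-cancelˡ)

ι : ℕ → ℚ
ι k = fromℤ (+ k)

ι-injective : Injective _≡_ _≡_ ι
ι-injective eq = ℤ.+-injective (cong ↥_ eq)

σ-replicate-0 : ∀ k p → σ (suc k) (replicate p 0ℚ) ≡ 0ℚ
σ-replicate-0 k zero    = refl
σ-replicate-0 k (suc p) =
  cong₂ _+_ (*-zeroˡ (σ k (replicate p 0ℚ))) (σ-replicate-0 k p)

σ-++-replicate-0 : ∀ {m} k (xs : Vec ℚ m) p → σ k (xs ++ replicate p 0ℚ) ≡ σ k xs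
σ-++-replicate-0 zero    xs       p = refl
σ-++-replicate-0 (suc k) []       p = σ-replicate-0 k p
σ-++-replicate-0 (suc k) (x ∷ xs) p =
  cong₂ (λ a b → x * a + b) (σ-++-replicate-0 k xs p) (σ-++-replicate-0 (suc k) xs p)

σ-map-* : ∀ {m} k l (xs : Vec ℚ m) → σ k (map (l *_) xs) ≡ l ^ k * σ k xs
σ-map-* zero    l xs       = sym (*-identityˡ 1ℚ)
σ-map-* (suc k) l []       = sym (*-zeroʳ (l ^ suc k))
σ-map-* (suc k) l (x ∷ xs) = begin
  l * x * σ k (map (l *_) xs) + σ (suc k) (map (l *_) xs)
    ≡⟨ cong₂ (λ a b → l * x * a + b) (σ-map-* k l xs) (σ-map-* (suc k) l xs) ⟩
  l * x * (l ^ k * σ k xs) + l * l ^ k * σ (suc k) xs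
    ≡⟨ solve 5 (λ l x lᵏ a b → l :* x :* (lᵏ :* a) :+ l :* lᵏ :* b
                           := l :* lᵏ :* (x :* a :+ b)) refl l x (l ^ k) (σ k xs) (σ (suc k) xs) ⟩
  l * l ^ k * (x * σ k xs + σ (suc k) xs)
    ∎
  where open ≡-Reasoning

Solves-++-replicate-0 : ∀ {m} abc (xs : Vec ℚ m) p → Solves abc xs → Solves abc (xs ++ replicate p 0ℚ)
Solves-++-replicate-0 abc xs p (e₁ , e₂ , e₃) =
  trans (σ-++-replicate-0 1 xs p) e₁ , trans (σ-++-replicate-0 2 xs p) e₂ , trans (σ-++-replicate-0 3 xs p) e₃

Solves-map-* : ∀ {m} a b c l (xs : Vec ℚ m) →
  Solves (a , b , c) xs → Solves (l ^ 1 * a , l ^ 2 * b , l ^ 3 * c) (map (l *_) xs)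
Solves-map-* a b c l xs (e₁ , e₂ , e₃) =
  trans (σ-map-* 1 l xs) (cong (l ^ 1 *_) e₁) ,
  trans (σ-map-* 2 l xs) (cong (l ^ 2 *_) e₂) ,
  trans (σ-map-* 3 l xs) (cong (l ^ 3 *_) e₃)

-- ⟦ σᴾ k ps ⟧ unfolds to σ k of the interpreted vector, so the solver can expand σ on symbolic vectors.
σᴾ : ∀ {n m} → ℕ → Vec (Polynomial n) m → Polynomial n
σᴾ zero    _        = con 1ℚ
σᴾ (suc k) []       = con 0ℚ
σᴾ (suc k) (p ∷ ps) = p :* σᴾ k ps :+ σᴾ (suc k) ps

twoPairs : ℚ → ℚ → Vec ℚ 4
twoPairs u v = 1ℚ + u ∷ 1ℚ - u ∷ 1ℚ + v ∷ 1ℚ - v ∷ []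

twoPairsᴾ : ∀ {n} → Polynomial n → Polynomial n → Vec (Polynomial n) 4
twoPairsᴾ u v = con 1ℚ :+ u ∷ con 1ℚ :- u ∷ con 1ℚ :+ v ∷ con 1ℚ :- v ∷ []

σ₁-twoPairs : ∀ u v → σ 1 (twoPairs u v) ≡ ι 4
σ₁-twoPairs = solve 2 (λ u v → σᴾ 1 (twoPairsᴾ u v) := con (ι 4)) refl

σ₂-twoPairs : ∀ u v → σ 2 (twoPairs u v) ≡ ι 6 - (u * u + v * v)
σ₂-twoPairs = solve 2 (λ u v → σᴾ 2 (twoPairsᴾ u v) := con (ι 6) :- (u :* u :+ v :* v)) refl

σ₃-twoPairs : ∀ u v → σ 3 (twoPairs u v) ≡ ι 4 - ι 2 * (u * u + v * v)
σ₃-twoPairs = solve 2 (λ u v → σᴾ 3 (twoPairsᴾ u v) := con (ι 4) :- con (ι 2) :* (u :* u :+ v :* v)) refl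

twoPairs-solves : ∀ u v → u * u + v * v ≡ 1ℚ → Solves (ι 4 , ι 5 , ι 2) (twoPairs u v)
twoPairs-solves u v onCircle =
  σ₁-twoPairs u v ,
  trans (σ₂-twoPairs u v) (cong (λ r → ι 6 - r) onCircle) ,
  trans (σ₃-twoPairs u v) (cong (λ r → ι 4 - ι 2 * r) onCircle)

*-cancelʳ-≡ : ∀ {x y} c .{{_ : NonZero c}} → x * c ≡ y * c → x ≡ y
*-cancelʳ-≡ {x} {y} c eq = begin
  x                ≡⟨ sym (*-identityʳ x) ⟩
  x * 1ℚ           ≡⟨ cong (x *_) (sym (*-inverseʳ c)) ⟩
  x * (c * 1/ c)   ≡⟨ sym (*-assoc x c (1/ c)) ⟩
  x * c * 1/ c     ≡⟨ cong (_* 1/ c) eq ⟩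
  y * c * 1/ c     ≡⟨ *-assoc y c (1/ c) ⟩
  y * (c * 1/ c)   ≡⟨ cong (y *_) (*-inverseʳ c) ⟩
  y * 1ℚ           ≡⟨ *-identityʳ y ⟩
  y                ∎
  where open ≡-Reasoning

-- t ≥ 0 only to get 1 + t² > 0 from the library's sign lemmas, which have no t² ≥ 0.
module _ (t : ℚ) .{{_ : NonNegative t}} where

  private instance
    1+t²-positive : Positive (1ℚ + t * t)
    1+t²-positive = pos+nonNeg⇒pos 1ℚ (t * t) {{nonNeg*nonNeg⇒nonNeg t t}}

    1+t²-nonZero : NonZero (1ℚ + t * t)
    1+t²-nonZero = pos⇒nonZero (1ℚ + t * t)

  circleWeight : ℚ
  circleWeight = 1/ (1ℚ + t * t)

  circleWeight-positive : Positive circleWeight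
  circleWeight-positive = 1/pos⇒pos (1ℚ + t * t)

  circleWeight-defect : 1ℚ - circleWeight * (1ℚ + t * t) ≡ 0ℚ
  circleWeight-defect = trans (cong (λ r → 1ℚ - r) (*-inverseˡ (1ℚ + t * t))) (+-inverseʳ 1ℚ)

  -- The second intersection of the unit circle with the line of slope t through (-1, 0).
  circlePoint : ℚ × ℚ
  circlePoint = (1ℚ - t * t) * circleWeight , (t + t) * circleWeight

  private
    w = circleWeight
    u = proj₁ circlePoint
    v = proj₂ circlePoint

    modulo-defect : ∀ {x} y c → x ≡ y + c * (1ℚ - w * (1ℚ + t * t)) → x ≡ y
    modulo-defect {x} y c eq = begin
      x                                ≡⟨ eq ⟩
      y + c * (1ℚ - w * (1ℚ + t * t))  ≡⟨ cong (λ d → y + c * d) circleWeight-defect ⟩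
      y + c * 0ℚ                       ≡⟨ solve 2 (λ y c → y :+ c :* con 0ℚ := y) refl y c ⟩
      y                                ∎
      where open ≡-Reasoning

  circlePoint-onCircle : u * u + v * v ≡ 1ℚ
  circlePoint-onCircle = modulo-defect 1ℚ (- (1ℚ + w * (1ℚ + t * t)))
    (solve 2 (λ t w → let u = (con 1ℚ :- t :* t) :* w ; v = (t :+ t) :* w in
      u :* u :+ v :* v := con 1ℚ :+ (:- (con 1ℚ :+ w :* (con 1ℚ :+ t :* t))) :* (con 1ℚ :- w :* (con 1ℚ :+ t :* t)))
      refl t w)

  1+circlePoint₁ : 1ℚ + u ≡ w + w
  1+circlePoint₁ = modulo-defect (w + w) 1ℚ
    (solve 2 (λ t w → con 1ℚ :+ (con 1ℚ :- t :* t) :* w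
                   := w :+ w :+ con 1ℚ :* (con 1ℚ :- w :* (con 1ℚ :+ t :* t))) refl t w)

  circlePoint-slope : t * (1ℚ + u) ≡ v
  circlePoint-slope = modulo-defect v t
    (solve 2 (λ t w → t :* (con 1ℚ :+ (con 1ℚ :- t :* t) :* w)
                   := (t :+ t) :* w :+ t :* (con 1ℚ :- w :* (con 1ℚ :+ t :* t))) refl t w)

circlePoint-injective : ∀ s t .{{_ : NonNegative s}} .{{_ : NonNegative t}} →
  circlePoint s ≡ circlePoint t → s ≡ t
circlePoint-injective s t eq = *-cancelʳ-≡ (1ℚ + u t) {{1+u-nonZero}} (begin
  s * (1ℚ + u t)  ≡⟨ cong (λ p → s * (1ℚ + proj₁ p)) (sym eq) ⟩
  s * (1ℚ + u s)  ≡⟨ circlePoint-slope s ⟩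
  v s             ≡⟨ cong proj₂ eq ⟩
  v t             ≡⟨ sym (circlePoint-slope t) ⟩
  t * (1ℚ + u t)  ∎)
  where
  open ≡-Reasoning
  u v : ∀ r .{{_ : NonNegative r}} → ℚ
  u r = proj₁ (circlePoint r)
  v r = proj₂ (circlePoint r)
  w = circleWeight t
  1+u-nonZero : NonZero (1ℚ + u t)
  1+u-nonZero = subst NonZero (sym (1+circlePoint₁ t))
    (pos⇒nonZero (w + w) {{pos+pos⇒pos w {{circleWeight-positive t}} w {{circleWeight-positive t}}}})

twoPairs-injective : ∀ {u u′ v v′} → twoPairs u v ≡ twoPairs u′ v′ → (u , v) ≡ (u′ , v′)
twoPairs-injective eq with ∷-injective eq
... | 1+u≡1+u′ , eq′ with ∷-injective (proj₂ (∷-injective eq′))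
... | 1+v≡1+v′ , _ = cong₂ _,_ (∙-cancelˡ 1ℚ _ _ 1+u≡1+u′) (∙-cancelˡ 1ℚ _ _ 1+v≡1+v′)

map-*-injective : ∀ {m} l .{{_ : NonZero l}} {xs ys : Vec ℚ m} → map (l *_) xs ≡ map (l *_) ys → xs ≡ ys
map-*-injective l {[]}     {[]}     _  = refl
map-*-injective l {x ∷ xs} {y ∷ ys} eq with ∷-injective eq
... | lx≡ly , eq′ = cong₂ _∷_ (*-cancelʳ-≡ l (trans (*-comm x l) (trans lx≡ly (*-comm l y))))
                              (map-*-injective l eq′)

scaledTriple : ℚ → ℚ × ℚ × ℚ
scaledTriple l = l ^ 1 * ι 4 , l ^ 2 * ι 5 , l ^ 3 * ι 2

scaledTriple-injective : Injective _≡_ _≡_ scaledTriple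
scaledTriple-injective {l} {l′} eq = begin
  l        ≡⟨ sym (*-identityʳ l) ⟩
  l ^ 1    ≡⟨ *-cancelʳ-≡ (ι 4) (cong proj₁ eq) ⟩
  l′ ^ 1   ≡⟨ *-identityʳ l′ ⟩
  l′       ∎
  where open ≡-Reasoning

solution : ∀ p → ℚ → (t : ℚ) .{{_ : NonNegative t}} → Vec ℚ (4 Data.Nat.+ p)
solution p l t = map (l *_) (uncurry twoPairs (circlePoint t)) ++ replicate p 0ℚ

solution-solves : ∀ p l t .{{_ : NonNegative t}} → Solves (scaledTriple l) (solution p l t)
solution-solves p l t = Solves-++-replicate-0 (scaledTriple l) (map (l *_) x) p
  (Solves-map-* (ι 4) (ι 5) (ι 2) l x (twoPairs-solves u v (circlePoint-onCircle t)))
  where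
  u = proj₁ (circlePoint t)
  v = proj₂ (circlePoint t)
  x = twoPairs u v

solution-injective : ∀ p l .{{_ : NonZero l}} s t .{{_ : NonNegative s}} .{{_ : NonNegative t}} →
  solution p l s ≡ solution p l t → s ≡ t
solution-injective p l s t eq =
  circlePoint-injective s t (twoPairs-injective (map-*-injective l (++-injectiveˡ _ _ eq)))

theorem5 : (n : ℕ) → n ≥ 5 →
    Infinitely (ℚ × ℚ × ℚ) (λ abc → Infinitely (Vec ℚ n) (λ x → Solves abc x))
theorem5 (suc (suc (suc (suc (suc m))))) (s≤s (s≤s (s≤s (s≤s (s≤s _))))) =
  (λ j → scaledTriple (ι (suc j))) ,
  (λ eq → ℕ.suc-injective (ι-injective (scaledTriple-injective eq))) ,
  λ j → (λ k → solution (suc m) (ι (suc j)) (ι k)) ,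
        (λ {k} {k′} eq → ι-injective (solution-injective (suc m) (ι (suc j)) (ι k) (ι k′) eq)) ,
        (λ k → solution-solves (suc m) (ι (suc j)) (ι k))
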